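{- There exists a partitioned balanced tournament design of side $9$; that is, for an $18$-element set $V$, there is a $9 \times 17$ array whose cells contain the $\binom{18}{2}=153$ distinct unordered pairs of elements of $V$, each pair in exactly one cell, such that: (1) every element of $V$ lies in exactly one cell of each column; (2) every element of $V$ lies in at most two cells of any row; (3) in each row, the pairs in the first $9$ columns form a factor of $V$; and (4) in each row, the pairs in the last $9$ columns form a factor of $V$.
   Context: A partitioned balanced tournament design of side $n$, PBTD($n$), on a $2n$-element set $V$ is an arrangement of the $\binom{2n}{2}$ distinct unordered pairs of elements of $V$ into the cells of an $n \times (2n-1)$ array (one pair per cell) such that every element of $V$ is in exactly one cell of each column, every element of $V$ is in at most two cells of any row, each row contains a factor in its first $n$ columns, and each row contains a factor in its last $n$ columns. A factor of $V$ is a set of $n$ pairwise disjoint unordered pairs whose union is $V$ (a perfect matching on $V$). -}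

module Defs where

open import Data.Nat using (ℕ; suc; _+_; _*_; _∸_; _≤_; _<_)
open import Data.Fin using (Fin; toℕ)
open import Data.Fin.Properties using (_≟_)
open import Data.Product using (Σ; _×_; _,_; ∃; ∃-syntax; proj₁; proj₂)
open import Data.Sum using (_⊎_)
open import Data.List using (List; length; filter)
open import Data.List.Base using (allFin)
open import Relation.Binary.PropositionalEquality using (_≡_)
open import Relation.Nullary using (Dec; yes; no; ¬_)
open import Data.Sum using (inj₁; inj₂)

-- An unordered pair of distinct elements of Fin v, stored canonically as (a , b) with a < b.
record UPair (v : ℕ) : Set where
  constructor upair
  field
    fst : Fin v
    snd : Fin v
    ordered : toℕ fst < toℕ snd
open UPair public

_∈ₚ_ : ∀ {v} → Fin v → UPair v → Set
x ∈ₚ p = (x ≡ fst p) ⊎ (x ≡ snd p)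

_∈ₚ?_ : ∀ {v} (x : Fin v) (p : UPair v) → Dec (x ∈ₚ p)
x ∈ₚ? p with x ≟ fst p | x ≟ snd p
... | yes e | _ = yes (inj₁ e)
... | no _ | yes e = yes (inj₂ e)
... | no ne₁ | no ne₂ = no λ { (inj₁ e) → ne₁ e ; (inj₂ e) → ne₂ e }

∃! : ∀ {A : Set} → (A → Set) → Set
∃! {A} P = Σ A λ a → P a × (∀ b → P b → b ≡ a)

Array : ℕ → Set
Array n = Fin n → Fin (2 * n ∸ 1) → UPair (2 * n)

rowCount : ∀ {n} → Array n → Fin n → Fin (2 * n) → ℕ
rowCount A r x = length (filter (λ c → x ∈ₚ? A r c) (allFin _))

-- A set of cells S (a predicate on columns) of row r forms a factor of Fin (2n):
-- its cells are n pairwise disjoint pairs covering every element, i.e. every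
-- element lies in exactly one cell of S.  (Columns range over S, which has
-- exactly n elements in both uses below.)
FactorOn : ∀ {n} → Array n → Fin n → (Fin (2 * n ∸ 1) → Set) → Set
FactorOn {n} A r S = ∀ (x : Fin (2 * n)) → ∃! (λ (c : Σ (Fin (2 * n ∸ 1)) S) → x ∈ₚ A r (proj₁ c))

record IsPBTD (n : ℕ) (A : Array n) : Set where
  field
    eachPairOnce : ∀ (p : UPair (2 * n)) → ∃! (λ (rc : Fin n × Fin (2 * n ∸ 1)) → A (proj₁ rc) (proj₂ rc) ≡ p)
    columnFactor : ∀ (c : Fin (2 * n ∸ 1)) (x : Fin (2 * n)) → ∃! (λ (r : Fin n) → x ∈ₚ A r c)
    rowAtMostTwo : ∀ (r : Fin n) (x : Fin (2 * n)) → rowCount A r x ≤ 2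
    firstFactor : ∀ (r : Fin n) → FactorOn A r (λ c → toℕ c < n)
    lastFactor : ∀ (r : Fin n) → FactorOn A r (λ c → n ∸ 1 ≤ toℕ c)

PBTD : ℕ → Set
PBTD n = Σ (Array n) (IsPBTD n)

-- The proof is by explicit construction.  A 9 × 17 array of pairs on
-- {0,…,17} is written down as a table, and each defining property of a
-- PBTD(9) is then a statement about finitely many cells and elements; such
-- statements are decidable, and the decision procedure, evaluated by the
-- type checker, certifies them ("proof by computation").
--
-- Two general facts reduce the properties to decidable form:
--   * unique existence over Fin k is decidable (∃!-dec), which settles the
--     column and factor conditions after restricting to a set of columns
--     (∃!-restrict);
--   * a map with a two-sided inverse hits every point exactly once
--     (inverse⇒∃!); the inverse of "pair in cell (r , c)" is found by
--     searching the array, and both round trips are checked by computation.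

module Submission where

open import Defs
open import Data.Nat using (ℕ; _<_; _≤_; _<?_; _≤?_)
open import Data.Nat.Properties using (≤-irrelevant)
open import Data.Nat.DivMod using (_mod_)
open import Data.Fin using (Fin; zero; toℕ)
open import Data.Fin.Properties using (any?; all?; _≟_)
open import Data.List using (allFin; cartesianProduct; find)
open import Data.Maybe using (fromMaybe)
open import Data.Vec using (Vec; lookup; []; _∷_)
open import Data.Product using (Σ; _×_; _,_; proj₁; proj₂)
open import Data.Product.Properties using (≡-dec)
open import Relation.Nullary using (Dec)
open import Relation.Nullary.Decidable using (from-yes; _×-dec_; _→-dec_)
open import Relation.Binary.PropositionalEquality using (_≡_; refl; cong; sym; trans)

∃!-dec : ∀ {k} {P : Fin k → Set} → (∀ i → Dec (P i)) → Dec (∃! P)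
∃!-dec P? = any? λ i → P? i ×-dec all? λ j → P? j →-dec (j ≟ i)

∃!-restrict : ∀ {A : Set} {S Q : A → Set} → (∀ {a} (u v : S a) → u ≡ v) →
              ∃! (λ a → S a × Q a) → ∃! (λ (a : Σ A S) → Q (proj₁ a))
∃!-restrict {A} {S} {Q} S-irr (a , (s , q) , unique) =
  (a , s) , q , λ { (a′ , s′) q′ → same-point (unique a′ (s′ , q′)) s′ }
  where
  same-point : ∀ {a′} → a′ ≡ a → (s′ : S a′) → (a′ , s′) ≡ (a , s)
  same-point refl s′ = cong (a ,_) (S-irr s′ s)

inverse⇒∃! : ∀ {C P : Set} (f : C → P) (g : P → C) →
             (∀ p → f (g p) ≡ p) → (∀ c → g (f c) ≡ c) →
             ∀ p → ∃! (λ c → f c ≡ p)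
inverse⇒∃! f g f∘g g∘f p = g p , f∘g p , λ c fc≡p → trans (sym (g∘f c)) (cong g fc≡p)

upair-≡ : ∀ {v} {p q : UPair v} → fst p ≡ fst q → snd p ≡ snd q → p ≡ q
upair-≡ {p = upair a b a<b} {q = upair .a .b a<b′} refl refl =
  cong (upair a b) (≤-irrelevant a<b a<b′)

pairTable : Vec (Vec (ℕ × ℕ) 17) 9
pairTable =
  ((3 , 6) ∷ (10 , 16) ∷ (8 , 15) ∷ (1 , 5) ∷ (7 , 11) ∷ (13 , 17) ∷ (2 , 14) ∷ (4 , 12) ∷ (0 , 9) ∷ (6 , 7) ∷ (13 , 14) ∷ (1 , 16) ∷ (2 , 4) ∷ (11 , 15) ∷ (3 , 17) ∷ (8 , 12) ∷ (5 , 10) ∷ []) ∷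
  ((4 , 7) ∷ (11 , 17) ∷ (6 , 16) ∷ (14 , 15) ∷ (2 , 3) ∷ (8 , 9) ∷ (0 , 12) ∷ (5 , 13) ∷ (1 , 10) ∷ (2 , 17) ∷ (7 , 8) ∷ (12 , 14) ∷ (0 , 5) ∷ (9 , 16) ∷ (4 , 15) ∷ (6 , 13) ∷ (3 , 11) ∷ []) ∷
  ((5 , 8) ∷ (9 , 15) ∷ (7 , 17) ∷ (6 , 10) ∷ (12 , 16) ∷ (0 , 4) ∷ (1 , 13) ∷ (3 , 14) ∷ (2 , 11) ∷ (12 , 13) ∷ (0 , 15) ∷ (6 , 8) ∷ (1 , 3) ∷ (10 , 17) ∷ (5 , 16) ∷ (7 , 14) ∷ (4 , 9) ∷ []) ∷
  ((2 , 9) ∷ (0 , 6) ∷ (10 , 13) ∷ (4 , 8) ∷ (1 , 14) ∷ (11 , 16) ∷ (5 , 17) ∷ (7 , 15) ∷ (3 , 12) ∷ (0 , 1) ∷ (16 , 17) ∷ (4 , 10) ∷ (6 , 11) ∷ (5 , 7) ∷ (9 , 14) ∷ (2 , 15) ∷ (8 , 13) ∷ []) ∷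
  ((0 , 10) ∷ (1 , 7) ∷ (11 , 14) ∷ (9 , 17) ∷ (5 , 6) ∷ (2 , 12) ∷ (3 , 15) ∷ (8 , 16) ∷ (4 , 13) ∷ (5 , 11) ∷ (1 , 2) ∷ (15 , 17) ∷ (7 , 9) ∷ (3 , 8) ∷ (10 , 12) ∷ (0 , 16) ∷ (6 , 14) ∷ []) ∷
  ((1 , 11) ∷ (2 , 8) ∷ (9 , 12) ∷ (0 , 13) ∷ (10 , 15) ∷ (3 , 7) ∷ (4 , 16) ∷ (6 , 17) ∷ (5 , 14) ∷ (15 , 16) ∷ (3 , 9) ∷ (0 , 2) ∷ (8 , 10) ∷ (4 , 6) ∷ (11 , 13) ∷ (1 , 17) ∷ (7 , 12) ∷ []) ∷
  ((13 , 16) ∷ (5 , 12) ∷ (0 , 3) ∷ (2 , 7) ∷ (4 , 17) ∷ (10 , 14) ∷ (8 , 11) ∷ (1 , 9) ∷ (6 , 15) ∷ (3 , 4) ∷ (10 , 11) ∷ (7 , 13) ∷ (12 , 17) ∷ (0 , 14) ∷ (1 , 8) ∷ (5 , 9) ∷ (2 , 16) ∷ []) ∷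
  ((14 , 17) ∷ (3 , 13) ∷ (1 , 4) ∷ (11 , 12) ∷ (0 , 8) ∷ (5 , 15) ∷ (6 , 9) ∷ (2 , 10) ∷ (7 , 16) ∷ (8 , 14) ∷ (4 , 5) ∷ (9 , 11) ∷ (13 , 15) ∷ (1 , 12) ∷ (2 , 6) ∷ (3 , 10) ∷ (0 , 17) ∷ []) ∷
  ((12 , 15) ∷ (4 , 14) ∷ (2 , 5) ∷ (3 , 16) ∷ (9 , 13) ∷ (1 , 6) ∷ (7 , 10) ∷ (0 , 11) ∷ (8 , 17) ∷ (9 , 10) ∷ (6 , 12) ∷ (3 , 5) ∷ (14 , 16) ∷ (2 , 13) ∷ (0 , 7) ∷ (4 , 11) ∷ (1 , 15) ∷ []) ∷
  []

low high : Fin 9 → Fin 17 → Fin 18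
low r c = proj₁ (lookup (lookup pairTable r) c) mod 18
high r c = proj₂ (lookup (lookup pairTable r) c) mod 18

low<high : ∀ r c → toℕ (low r c) < toℕ (high r c)
low<high = from-yes (all? λ r → all? λ c → toℕ (low r c) <? toℕ (high r c))

design : Array 9
design r c = upair (low r c) (high r c) (low<high r c)

-- The cell holding the pair {a , b} (a < b), found by searching all cells;
-- the default is never used, as cellOf-correct shows.
cellOf : Fin 18 → Fin 18 → Fin 9 × Fin 17
cellOf a b = fromMaybe (zero , zero)
  (find (λ (r , c) → (low r c ≟ a) ×-dec (high r c ≟ b))
        (cartesianProduct (allFin 9) (allFin 17)))

cellOf-correct : ∀ a b → toℕ a < toℕ b →
                 (low (proj₁ (cellOf a b)) (proj₂ (cellOf a b)) ≡ a) ×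
                 (high (proj₁ (cellOf a b)) (proj₂ (cellOf a b)) ≡ b)
cellOf-correct = from-yes (all? λ a → all? λ b → (toℕ a <? toℕ b) →-dec
  ((low (proj₁ (cellOf a b)) (proj₂ (cellOf a b)) ≟ a) ×-dec
   (high (proj₁ (cellOf a b)) (proj₂ (cellOf a b)) ≟ b)))

-- No pair occurs twice: the search recovers each cell from its pair.
cellOf-design : ∀ r c → cellOf (low r c) (high r c) ≡ (r , c)
cellOf-design = from-yes (all? λ r → all? λ c → ≡-dec _≟_ _≟_ (cellOf (low r c) (high r c)) (r , c))

eachPairOnce : ∀ (p : UPair 18) → ∃! (λ (rc : Fin 9 × Fin 17) → design (proj₁ rc) (proj₂ rc) ≡ p)
eachPairOnce = inverse⇒∃! (λ (r , c) → design r c) (λ p → cellOf (fst p) (snd p))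
  (λ (upair a b a<b) → upair-≡ (proj₁ (cellOf-correct a b a<b)) (proj₂ (cellOf-correct a b a<b)))
  (λ (r , c) → cellOf-design r c)

columnFactor : ∀ (c : Fin 17) (x : Fin 18) → ∃! (λ (r : Fin 9) → x ∈ₚ design r c)
columnFactor = from-yes (all? λ c → all? λ x → ∃!-dec λ r → x ∈ₚ? design r c)

rowAtMostTwo : ∀ (r : Fin 9) (x : Fin 18) → rowCount design r x ≤ 2
rowAtMostTwo = from-yes (all? λ r → all? λ x → rowCount design r x ≤? 2)

firstFactor : ∀ (r : Fin 9) → FactorOn design r (λ c → toℕ c < 9)
firstFactor r x = ∃!-restrict ≤-irrelevant (checked r x)
  where
  checked : ∀ r x → ∃! (λ c → (toℕ c < 9) × x ∈ₚ design r c)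
  checked = from-yes (all? λ r → all? λ x → ∃!-dec λ c → (toℕ c <? 9) ×-dec (x ∈ₚ? design r c))

lastFactor : ∀ (r : Fin 9) → FactorOn design r (λ c → 8 ≤ toℕ c)
lastFactor r x = ∃!-restrict ≤-irrelevant (checked r x)
  where
  checked : ∀ r x → ∃! (λ c → (8 ≤ toℕ c) × x ∈ₚ design r c)
  checked = from-yes (all? λ r → all? λ x → ∃!-dec λ c → (8 ≤? toℕ c) ×-dec (x ∈ₚ? design r c))

mainTheorem1 : PBTD 9
mainTheorem1 = design , record
  { eachPairOnce = eachPairOnce
  ; columnFactor = columnFactor
  ; rowAtMostTwo = rowAtMostTwo
  ; firstFactor  = firstFactor
  ; lastFactor   = lastFactor
  }
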